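{- Let $f(t)=\sum_{m=0}^{\infty}a_m t^m$ be a formal power series with complex coefficients and let $x,y,z$ be indeterminates. Then, as identities of formal power series in $x,y,z$, $$\sum_{n=0}^{\infty}\frac{x^n}{n!}\left\{\sum_{k=0}^n\binom{n}{k}(-1)^k f(y+zk)\right\} = \sum_{m=0}^{\infty}a_m\left\{\sum_{p=0}^m\binom{m}{p}z^p y^{m-p}\varphi_p(-x)\right\},$$ and, in the case $y=0$, $$\sum_{n=0}^{\infty}\frac{x^n}{n!}\left\{\sum_{k=0}^n\binom{n}{k}(-1)^k f(zk)\right\} = \sum_{m=0}^{\infty}a_m\varphi_m(-x)z^m.$$
   Context: $S(m,n)$ denotes the Stirling numbers of the second kind, $S(m,n)=\frac{(-1)^n}{n!}\sum_{k=0}^n\binom{n}{k}(-1)^k k^m$. The exponential polynomials are $\varphi_m(x)=\sum_{n=0}^m S(m,n)x^n$ for $m\ge 0$. -}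

module Defs where

open import Level using (Level)
open import Data.Nat as ℕ using (ℕ; zero; suc; _∸_; _!)
open import Data.Nat.Properties using (_!≢0)
open import Data.Nat.Combinatorics using (_C_)
open import Data.Integer using (+_)
import Data.Rational as ℚ
open ℚ using (ℚ)
open import Algebra.Bundles using (CommutativeRing)

sumℚ : ℕ → (ℕ → ℚ) → ℚ
sumℚ zero    g = g zero
sumℚ (suc n) g = sumℚ n g ℚ.+ g (suc n)

nℚ : ℕ → ℚ
nℚ k = (+ k) ℚ./ 1

powℚ : ℚ → ℕ → ℚ
powℚ q zero    = ℚ.1ℚ
powℚ q (suc k) = q ℚ.* powℚ q k

invFact : ℕ → ℚ
invFact n = (+ 1 ℚ./ (n !)) {{n !≢0}}

Stirling2 : ℕ → ℕ → ℚ
Stirling2 m n =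
  powℚ (ℚ.- ℚ.1ℚ) n ℚ.* invFact n ℚ.*
  sumℚ n (λ k → nℚ (n C k) ℚ.* powℚ (ℚ.- ℚ.1ℚ) k ℚ.* powℚ (nℚ k) m)

-- Formal power series in three indeterminates x, y, z over a
-- commutative ring R equipped with a map ι : ℚ → R (in the theorem ι is
-- required to be a ring homomorphism, i.e. R is a ℚ-algebra, e.g. ℂ).

module PS {c ℓ : Level} (R : CommutativeRing c ℓ)
          (ι : ℚ → CommutativeRing.Carrier R) where

  open CommutativeRing R hiding (zero)

  sumR : ℕ → (ℕ → Carrier) → Carrier
  sumR zero    g = g zero
  sumR (suc n) g = sumR n g + g (suc n)

  -- F n i j is the coefficient of x^n y^i z^j
  PS3 : Set c
  PS3 = ℕ → ℕ → ℕ → Carrier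

  infix 4 _≋_
  _≋_ : PS3 → PS3 → Set ℓ
  F ≋ G = ∀ n i j → F n i j ≈ G n i j

  infixl 6 _⊕_
  infixl 7 _⊗_
  infixr 7 _•_

  _⊕_ : PS3 → PS3 → PS3
  (F ⊕ G) n i j = F n i j + G n i j

  ⊖_ : PS3 → PS3
  (⊖ F) n i j = - (F n i j)

  _•_ : Carrier → PS3 → PS3
  (r • F) n i j = r * F n i j

  _⊗_ : PS3 → PS3 → PS3
  (F ⊗ G) n i j =
    sumR n (λ a → sumR i (λ b → sumR j (λ d →
      F a b d * G (n ∸ a) (i ∸ b) (j ∸ d))))

  const : Carrier → PS3
  const r zero zero zero = r
  const r _    _    _    = 0#

  X Y Z : PS3
  X (suc zero) zero zero = 1#
  X _ _ _ = 0#
  Y zero (suc zero) zero = 1#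
  Y _ _ _ = 0#
  Z zero zero (suc zero) = 1#
  Z _ _ _ = 0#

  infixr 8 _^^_
  _^^_ : PS3 → ℕ → PS3
  F ^^ zero  = const 1#
  F ^^ suc k = F ⊗ (F ^^ k)

  sumPS : ℕ → (ℕ → PS3) → PS3
  sumPS n g x i j = sumR n (λ k → g k x i j)

  -- infinite sum Σ_{m≥0} g m of a family in which g m has total order
  -- ≥ m (all coefficients of total degree < m vanish); for such families
  -- the coefficient of x^n y^i z^j only receives contributions from
  -- m ≤ n+i+j, so this is the (formal-topology) sum.
  Σ∞ : (ℕ → PS3) → PS3
  Σ∞ g n i j = sumR (n ℕ.+ i ℕ.+ j) (λ m → g m n i j)

  natR : ℕ → Carrier
  natR k = ι (nℚ k)

  binomR : ℕ → ℕ → Carrier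
  binomR n k = ι (nℚ (n C k))

  signR : ℕ → Carrier
  signR k = ι (powℚ (ℚ.- ℚ.1ℚ) k)

  -- f(G) = Σ_m a_m G^m for f(t) = Σ a_m t^m and G with zero constant term
  compose : (ℕ → Carrier) → PS3 → PS3
  compose a G = Σ∞ (λ m → a m • (G ^^ m))

  φ : ℕ → PS3 → PS3
  φ m G = sumPS m (λ n → ι (Stirling2 m n) • (G ^^ n))

module Submission where

-- Both identities are proved coefficientwise, at x^n y^i z^j.
--
-- Left side: by the binomial theorem, f(Y + kZ) has coefficient
-- A k^j at y^i z^j (no x), with A = a_{i+j} C(i+j,j); for f(kZ) it is
-- A = [i = 0] a_j.  So the left coefficient is A (1/n!) Σ_k C(n,k)(-1)^k k^j.
-- Right side: φ_p(-X) has x^n-coefficient [n ≤ p] S(p,n)(-1)^n and the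
-- monomials z^p y^(m-p) (resp. z^m) select p = j, so the right coefficient
-- is A [n ≤ j] S(j,n)(-1)^n.  For n ≤ j the two agree by the defining
-- formula of S(j,n); for n > j both vanish since Σ_k C(n,k)(-1)^k (k+c)^j,
-- an n-th finite difference of a polynomial of degree j < n, is 0.

open import Defs
open import Level using (Level)
open import Data.Nat using (ℕ; _∸_)
open import Data.Product using (_×_)
open import Data.Rational using (ℚ)
open import Data.Rational.Properties using (+-*-commutativeRing)
open import Algebra.Bundles using (CommutativeRing)
open import Algebra.Morphism.Structures using (IsRingHomomorphism)

open import Data.Nat as ℕ using (zero; suc)
import Data.Nat.Properties as ℕP
open import Data.Nat.Combinatorics
  using (_C_; k>n⇒nCk≡0; nCk+nC[k+1]≡[n+1]C[k+1]; nC1≡n; nCn≡1)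
open import Data.Nat.Tactic.RingSolver using (solve-∀)
open import Data.Integer as ℤ using (+_)
import Data.Integer.Tactic.RingSolver as ℤSolver
import Data.Integer.Properties as ℤP
import Data.Rational as ℚ
import Data.Rational.Properties as ℚP
import Data.Rational.Unnormalised as ℚᵘ
import Data.Rational.Unnormalised.Properties as ℚᵘP
open import Data.Product using (_,_)
open import Data.Maybe using (Maybe; just; nothing)
open import Relation.Nullary using (yes; no)
import Relation.Binary.PropositionalEquality as P
open P using (_≡_)
open import Algebra.Solver.Ring.AlmostCommutativeRing
  using (fromCommutativeRing; _-Raw-AlmostCommutative⟶_)

-- The embedding nℚ : ℕ → ℚ, k ↦ k/1, preserves + and *; this is what lets
-- natural-number identities be transported into R.
module NatToℚ where
  open P using (trans; cong)

  nᵘ : ℕ → ℚᵘ.ℚᵘ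
  nᵘ k = ℚᵘ.mkℚᵘ (+ k) 0

  toℚᵘ-nℚ : ∀ k → ℚ.toℚᵘ (nℚ k) ℚᵘ.≃ nᵘ k
  toℚᵘ-nℚ k = ℚP.toℚᵘ-fromℚᵘ (nᵘ k)

  nℚ-+ : ∀ a b → nℚ (a ℕ.+ b) ≡ nℚ a ℚ.+ nℚ b
  nℚ-+ a b = ℚP.toℚᵘ-injective (ℚᵘP.≃-trans (toℚᵘ-nℚ (a ℕ.+ b))
    (ℚᵘP.≃-sym (ℚᵘP.≃-trans (ℚP.toℚᵘ-homo-+ (nℚ a) (nℚ b))
      (ℚᵘP.≃-trans (ℚᵘP.+-cong (toℚᵘ-nℚ a) (toℚᵘ-nℚ b)) (ℚᵘ.*≡* (cross (+ a) (+ b)))))))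
    where
    cross : ∀ (a b : ℤ.ℤ) → (a ℤ.* + 1 ℤ.+ b ℤ.* + 1) ℤ.* + 1 ≡ (a ℤ.+ b) ℤ.* (+ 1 ℤ.* + 1)
    cross = ℤSolver.solve-∀

  nℚ-* : ∀ a b → nℚ (a ℕ.* b) ≡ nℚ a ℚ.* nℚ b
  nℚ-* a b = ℚP.toℚᵘ-injective (ℚᵘP.≃-trans (toℚᵘ-nℚ (a ℕ.* b))
    (ℚᵘP.≃-sym (ℚᵘP.≃-trans (ℚP.toℚᵘ-homo-* (nℚ a) (nℚ b))
      (ℚᵘP.≃-trans (ℚᵘP.*-cong (toℚᵘ-nℚ a) (toℚᵘ-nℚ b))
        (ℚᵘ.*≡* (trans (cross (+ a) (+ b)) (cong (ℤ._* (+ 1 ℤ.* + 1)) (P.sym (ℤP.pos-* a b)))))))))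
    where
    cross : ∀ (a b : ℤ.ℤ) → (a ℤ.* b) ℤ.* + 1 ≡ (a ℤ.* b) ℤ.* (+ 1 ℤ.* + 1)
    cross = ℤSolver.solve-∀

open NatToℚ using (nℚ-+; nℚ-*)

-- Absorption identity (k+1) C(n+1,k+1) = (n+1) C(n,k), by Pascal's rule.
-- It is the step that lowers the exponent j in the finite-difference argument.
suc-*-C : ∀ n k → suc k ℕ.* (suc n C suc k) ≡ suc n ℕ.* (n C k)
suc-*-C zero zero = P.refl
suc-*-C zero (suc k) rewrite k>n⇒nCk≡0 {1} {suc (suc k)} (ℕ.s≤s (ℕ.s≤s ℕ.z≤n)) =
  ℕP.*-zeroʳ (suc (suc k))
suc-*-C (suc n) zero = P.trans (ℕP.+-identityʳ _) (P.trans (nC1≡n (suc (suc n))) (P.sym (ℕP.*-identityʳ _)))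
suc-*-C (suc n) (suc k) = begin
  suc (suc k) ℕ.* (suc (suc n) C suc (suc k))
    ≡⟨ P.cong (suc (suc k) ℕ.*_) (P.sym (nCk+nC[k+1]≡[n+1]C[k+1] (suc n) (suc k))) ⟩
  suc (suc k) ℕ.* (A ℕ.+ B)
    ≡⟨ spread k A B ⟩
  A ℕ.+ (suc k ℕ.* A ℕ.+ suc (suc k) ℕ.* B)
    ≡⟨ P.cong₂ (λ p q → A ℕ.+ (p ℕ.+ q)) (suc-*-C n k) (suc-*-C n (suc k)) ⟩
  A ℕ.+ (suc n ℕ.* (n C k) ℕ.+ suc n ℕ.* (n C suc k))
    ≡⟨ P.cong (A ℕ.+_) (P.sym (ℕP.*-distribˡ-+ (suc n) (n C k) (n C suc k))) ⟩
  A ℕ.+ suc n ℕ.* (n C k ℕ.+ n C suc k)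
    ≡⟨ P.cong (λ p → A ℕ.+ suc n ℕ.* p) (nCk+nC[k+1]≡[n+1]C[k+1] n k) ⟩
  A ℕ.+ suc n ℕ.* A ∎
  where
  open P.≡-Reasoning
  A = suc n C suc k
  B = suc n C suc (suc k)
  spread : ∀ k A B → suc (suc k) ℕ.* (A ℕ.+ B) ≡ A ℕ.+ (suc k ℕ.* A ℕ.+ suc (suc k) ℕ.* B)
  spread = solve-∀

module Coefficients {c ℓ : Level} (R : CommutativeRing c ℓ)
  (ι : ℚ → CommutativeRing.Carrier R)
  (hom : IsRingHomomorphism (CommutativeRing.rawRing +-*-commutativeRing) (CommutativeRing.rawRing R) ι)
  where

  open CommutativeRing R hiding (zero)
  open IsRingHomomorphism hom
  open PS R ι
  open import Relation.Binary.Reasoning.Setoid setoid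
  open import Algebra.Properties.Ring ring using (-0#≈0#)

  ℚ→R : CommutativeRing.rawRing +-*-commutativeRing -Raw-AlmostCommutative⟶ fromCommutativeRing R
  ℚ→R = record { ⟦_⟧ = ι ; +-homo = +-homo ; *-homo = *-homo ; -‿homo = -‿homo ; 0-homo = 0#-homo ; 1-homo = 1#-homo }

  ℚ-coefficients≟ : ∀ x y → Maybe (ι x ≈ ι y)
  ℚ-coefficients≟ x y with x ℚ.≟ y
  ... | yes x≡y = just (reflexive (P.cong ι x≡y))
  ... | no _ = nothing

  open import Algebra.Solver.Ring (CommutativeRing.rawRing +-*-commutativeRing) (fromCommutativeRing R) ℚ→R ℚ-coefficients≟
    using (solve; _:+_; _:*_; :-_; _:=_)

  sumR-cong : ∀ n {f g} → (∀ k → f k ≈ g k) → sumR n f ≈ sumR n g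
  sumR-cong zero f≈g = f≈g 0
  sumR-cong (suc n) f≈g = +-cong (sumR-cong n f≈g) (f≈g (suc n))

  sumR-cong≤ : ∀ n {f g} → (∀ k → k ℕ.≤ n → f k ≈ g k) → sumR n f ≈ sumR n g
  sumR-cong≤ zero f≈g = f≈g 0 ℕ.z≤n
  sumR-cong≤ (suc n) f≈g =
    +-cong (sumR-cong≤ n (λ k k≤n → f≈g k (ℕP.m≤n⇒m≤1+n k≤n))) (f≈g (suc n) ℕP.≤-refl)

  sumR-+ : ∀ n f g → sumR n (λ k → f k + g k) ≈ sumR n f + sumR n g
  sumR-+ zero f g = refl
  sumR-+ (suc n) f g = begin
    sumR n (λ k → f k + g k) + (f (suc n) + g (suc n))
      ≈⟨ +-congʳ (sumR-+ n f g) ⟩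
    (sumR n f + sumR n g) + (f (suc n) + g (suc n))
      ≈⟨ solve 4 (λ a b c d → (a :+ b) :+ (c :+ d) := (a :+ c) :+ (b :+ d)) refl
           (sumR n f) (sumR n g) (f (suc n)) (g (suc n)) ⟩
    (sumR n f + f (suc n)) + (sumR n g + g (suc n)) ∎

  sumR-*ˡ : ∀ n x f → sumR n (λ k → x * f k) ≈ x * sumR n f
  sumR-*ˡ zero x f = refl
  sumR-*ˡ (suc n) x f = trans (+-congʳ (sumR-*ˡ n x f)) (sym (distribˡ x _ _))

  sumR-neg : ∀ n f → sumR n (λ k → - f k) ≈ - sumR n f
  sumR-neg zero f = refl
  sumR-neg (suc n) f = trans (+-congʳ (sumR-neg n f))
    (solve 2 (λ a b → (:- a) :+ (:- b) := :- (a :+ b)) refl (sumR n f) (f (suc n)))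

  sumR-shift : ∀ n f → sumR (suc n) f ≈ f 0 + sumR n (λ k → f (suc k))
  sumR-shift zero f = refl
  sumR-shift (suc n) f = trans (+-congʳ (sumR-shift n f)) (+-assoc _ _ _)

  -- Coefficients of monomials and products are written with these, and
  -- sums against a delta collapse to a single summand.

  δ : ℕ → ℕ → Carrier
  δ zero zero = 1#
  δ zero (suc _) = 0#
  δ (suc _) zero = 0#
  δ (suc a) (suc b) = δ a b

  ind≤ : ℕ → ℕ → Carrier
  ind≤ zero _ = 1#
  ind≤ (suc a) zero = 0#
  ind≤ (suc a) (suc b) = ind≤ a b

  δ-sym : ∀ a b → δ a b ≡ δ b a
  δ-sym zero zero = P.refl
  δ-sym zero (suc b) = P.refl
  δ-sym (suc a) zero = P.refl
  δ-sym (suc a) (suc b) = δ-sym a b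

  δ-subst : ∀ a b (h : ℕ → Carrier) → δ a b * h a ≈ δ a b * h b
  δ-subst zero zero h = refl
  δ-subst zero (suc b) h = trans (zeroˡ _) (sym (zeroˡ _))
  δ-subst (suc a) zero h = trans (zeroˡ _) (sym (zeroˡ _))
  δ-subst (suc a) (suc b) h = δ-subst a b (λ x → h (suc x))

  ind≤-suc : ∀ a M → ind≤ a (suc M) ≈ ind≤ a M + δ a (suc M)
  ind≤-suc zero M = sym (+-identityʳ 1#)
  ind≤-suc (suc zero) zero = sym (+-identityˡ 1#)
  ind≤-suc (suc (suc a)) zero = sym (+-identityˡ 0#)
  ind≤-suc (suc a) (suc M) = ind≤-suc a M

  ind≤-≤ : ∀ {a b} → a ℕ.≤ b → ind≤ a b ≡ 1#
  ind≤-≤ ℕ.z≤n = P.refl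
  ind≤-≤ (ℕ.s≤s a≤b) = ind≤-≤ a≤b

  ind≤-> : ∀ {a b} → b ℕ.< a → ind≤ a b ≡ 0#
  ind≤-> {suc a} {zero} _ = P.refl
  ind≤-> {suc a} {suc b} (ℕ.s≤s b<a) = ind≤-> b<a

  ind≤-δ : ∀ a b n → ind≤ a n * δ b (n ∸ a) ≈ δ (a ℕ.+ b) n
  ind≤-δ zero b n = *-identityˡ _
  ind≤-δ (suc a) b zero = zeroˡ _
  ind≤-δ (suc a) b (suc n) = ind≤-δ a b n

  ind≤-δ0 : ∀ a n → ind≤ a n * δ 0 (n ∸ a) ≈ δ a n
  ind≤-δ0 a n = trans (ind≤-δ a 0 n) (reflexive (P.cong (λ x → δ x n) (ℕP.+-identityʳ a)))

  δ0-∸ : ∀ {a n} → a ℕ.≤ n → δ 0 (n ∸ a) ≡ δ a n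
  δ0-∸ {n = zero} ℕ.z≤n = P.refl
  δ0-∸ {n = suc n} ℕ.z≤n = P.refl
  δ0-∸ (ℕ.s≤s a≤n) = δ0-∸ a≤n

  sumR-δ : ∀ M a (h : ℕ → Carrier) → sumR M (λ x → δ a x * h x) ≈ ind≤ a M * h a
  sumR-δ zero zero h = refl
  sumR-δ zero (suc a) h = trans (zeroˡ _) (sym (zeroˡ _))
  sumR-δ (suc M) a h = begin
    sumR M (λ x → δ a x * h x) + δ a (suc M) * h (suc M)
      ≈⟨ +-cong (sumR-δ M a h) (sym (δ-subst a (suc M) h)) ⟩
    ind≤ a M * h a + δ a (suc M) * h a ≈⟨ sym (distribʳ _ _ _) ⟩
    (ind≤ a M + δ a (suc M)) * h a ≈⟨ *-congʳ (sym (ind≤-suc a M)) ⟩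
    ind≤ a (suc M) * h a ∎

  sumR-δ′ : ∀ M a (h : ℕ → Carrier) → sumR M (λ x → δ x a * h x) ≈ ind≤ a M * h a
  sumR-δ′ M a h = trans (sumR-cong M (λ x → reflexive (P.cong (_* h x) (δ-sym x a)))) (sumR-δ M a h)

  sumR-δ≤ : ∀ {M a} (h : ℕ → Carrier) → a ℕ.≤ M → sumR M (λ x → δ a x * h x) ≈ h a
  sumR-δ≤ {M} {a} h a≤M =
    trans (sumR-δ M a h) (trans (*-congʳ (reflexive (ind≤-≤ a≤M))) (*-identityˡ _))

  sumR-δ≤′ : ∀ {M a} (h : ℕ → Carrier) → a ℕ.≤ M → sumR M (λ x → δ x a * h x) ≈ h a
  sumR-δ≤′ {M} {a} h a≤M =
    trans (sumR-δ′ M a h) (trans (*-congʳ (reflexive (ind≤-≤ a≤M))) (*-identityˡ _))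

  ≋-refl : ∀ F → F ≋ F
  ≋-refl F n i j = refl

  ≋-trans : ∀ {F G H} → F ≋ G → G ≋ H → F ≋ H
  ≋-trans F≋G G≋H n i j = trans (F≋G n i j) (G≋H n i j)

  ⊗-cong : ∀ {F F′ G G′} → F ≋ F′ → G ≋ G′ → F ⊗ G ≋ F′ ⊗ G′
  ⊗-cong F≋F′ G≋G′ n i j =
    sumR-cong n (λ a → sumR-cong i (λ b → sumR-cong j (λ d → *-cong (F≋F′ a b d) (G≋G′ _ _ _))))

  ⊕-⊗ : ∀ F G H → (F ⊕ G) ⊗ H ≋ (F ⊗ H) ⊕ (G ⊗ H)
  ⊕-⊗ F G H n i j = begin
    sumR n (λ a → sumR i (λ b → sumR j (λ d → (F a b d + G a b d) * H′ a b d)))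
      ≈⟨ sumR-cong n (λ a → sumR-cong i (λ b → trans (sumR-cong j (λ d → distribʳ _ _ _)) (sumR-+ j _ _))) ⟩
    sumR n (λ a → sumR i (λ b → sumR j (λ d → F a b d * H′ a b d) + sumR j (λ d → G a b d * H′ a b d)))
      ≈⟨ sumR-cong n (λ a → sumR-+ i _ _) ⟩
    sumR n (λ a → sumR i (λ b → sumR j (λ d → F a b d * H′ a b d))
                  + sumR i (λ b → sumR j (λ d → G a b d * H′ a b d)))
      ≈⟨ sumR-+ n _ _ ⟩
    ((F ⊗ H) ⊕ (G ⊗ H)) n i j ∎
    where
    H′ : ℕ → ℕ → ℕ → Carrier
    H′ a b d = H (n ∸ a) (i ∸ b) (j ∸ d)

  mono : Carrier → ℕ → ℕ → ℕ → PS3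
  mono r a b d n i j = r * (δ a n * (δ b i * δ d j))

  mono-⊗ : ∀ r a₀ b₀ d₀ G n i j → (mono r a₀ b₀ d₀ ⊗ G) n i j ≈
    r * (ind≤ a₀ n * (ind≤ b₀ i * (ind≤ d₀ j * G (n ∸ a₀) (i ∸ b₀) (j ∸ d₀))))
  mono-⊗ r a₀ b₀ d₀ G n i j = begin
    sumR n (λ a → sumR i (λ b → sumR j (λ d → (r * (δ a₀ a * (δ b₀ b * δ d₀ d))) * G (n ∸ a) (i ∸ b) (j ∸ d))))
      ≈⟨ sumR-cong n (λ a → sumR-cong i (λ b → trans (sumR-cong j (λ d → rearrange r (δ a₀ a) (δ b₀ b) (δ d₀ d) _))
           (trans (sumR-*ˡ j _ _) (*-congˡ (trans (sumR-*ˡ j _ _) (*-congˡ (sumR-δ j d₀ _))))))) ⟩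
    sumR n (λ a → sumR i (λ b → δ a₀ a * (δ b₀ b * (ind≤ d₀ j * (r * G (n ∸ a) (i ∸ b) (j ∸ d₀))))))
      ≈⟨ sumR-cong n (λ a → trans (sumR-*ˡ i _ _) (*-congˡ (sumR-δ i b₀ _))) ⟩
    sumR n (λ a → δ a₀ a * (ind≤ b₀ i * (ind≤ d₀ j * (r * G (n ∸ a) (i ∸ b₀) (j ∸ d₀)))))
      ≈⟨ sumR-δ n a₀ _ ⟩
    ind≤ a₀ n * (ind≤ b₀ i * (ind≤ d₀ j * (r * G (n ∸ a₀) (i ∸ b₀) (j ∸ d₀))))
      ≈⟨ solve 5 (λ a b d r g → a :* (b :* (d :* (r :* g))) := r :* (a :* (b :* (d :* g)))) refl _ _ _ _ _ ⟩
    r * (ind≤ a₀ n * (ind≤ b₀ i * (ind≤ d₀ j * G (n ∸ a₀) (i ∸ b₀) (j ∸ d₀)))) ∎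
    where
    rearrange : ∀ r a b d g → (r * (a * (b * d))) * g ≈ a * (b * (d * (r * g)))
    rearrange = solve 5 (λ r a b d g → (r :* (a :* (b :* d))) :* g := a :* (b :* (d :* (r :* g)))) refl

  mono-mono : ∀ r a b d s a′ b′ d′ →
    mono r a b d ⊗ mono s a′ b′ d′ ≋ mono (r * s) (a ℕ.+ a′) (b ℕ.+ b′) (d ℕ.+ d′)
  mono-mono r a b d s a′ b′ d′ n i j = begin
    (mono r a b d ⊗ mono s a′ b′ d′) n i j ≈⟨ mono-⊗ r a b d (mono s a′ b′ d′) n i j ⟩
    r * (ind≤ a n * (ind≤ b i * (ind≤ d j * (s * (δ a′ (n ∸ a) * (δ b′ (i ∸ b) * δ d′ (j ∸ d)))))))
      ≈⟨ solve 8 (λ r s A x B y D z → r :* (A :* (B :* (D :* (s :* (x :* (y :* z))))))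
                  := (r :* s) :* ((A :* x) :* ((B :* y) :* (D :* z)))) refl r s _ _ _ _ _ _ ⟩
    (r * s) * ((ind≤ a n * δ a′ (n ∸ a)) * ((ind≤ b i * δ b′ (i ∸ b)) * (ind≤ d j * δ d′ (j ∸ d))))
      ≈⟨ *-congˡ (*-cong (ind≤-δ a a′ n) (*-cong (ind≤-δ b b′ i) (ind≤-δ d d′ j))) ⟩
    mono (r * s) (a ℕ.+ a′) (b ℕ.+ b′) (d ℕ.+ d′) n i j ∎

  mono-cong : ∀ {r s a a′ b b′ d d′} → r ≈ s → a ≡ a′ → b ≡ b′ → d ≡ d′ → mono r a b d ≋ mono s a′ b′ d′
  mono-cong r≈s P.refl P.refl P.refl n i j = *-congʳ r≈s

  •-mono : ∀ x r a b d → x • mono r a b d ≋ mono (x * r) a b d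
  •-mono x r a b d n i j = sym (*-assoc _ _ _)

  ⊖-mono : ∀ r a b d → ⊖ mono r a b d ≋ mono (- r) a b d
  ⊖-mono r a b d n i j = solve 2 (λ x y → :- (x :* y) := (:- x) :* y) refl _ _

  zero≈δ₁ : ∀ x → 0# ≈ 1# * (0# * x)
  zero≈δ₁ x = sym (trans (*-identityˡ _) (zeroˡ x))
  zero≈δ₂ : ∀ x → 0# ≈ 1# * (1# * (0# * x))
  zero≈δ₂ x = trans (zero≈δ₁ x) (*-congˡ (sym (*-identityˡ _)))
  zero≈δ₃ : 0# ≈ 1# * (1# * (1# * 0#))
  zero≈δ₃ = sym (trans (*-identityˡ _) (trans (*-identityˡ _) (zeroʳ _)))
  one≈δ₃ : 1# ≈ 1# * (1# * (1# * 1#))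
  one≈δ₃ = sym (trans (*-identityˡ _) (trans (*-identityˡ _) (*-identityˡ _)))

  const-mono : const 1# ≋ mono 1# 0 0 0
  const-mono zero zero zero = one≈δ₃
  const-mono zero zero (suc j) = zero≈δ₃
  const-mono zero (suc i) j = zero≈δ₂ _
  const-mono (suc n) i j = zero≈δ₁ _

  X-mono : X ≋ mono 1# 1 0 0
  X-mono zero i j = zero≈δ₁ _
  X-mono (suc zero) zero zero = one≈δ₃
  X-mono (suc zero) zero (suc j) = zero≈δ₃
  X-mono (suc zero) (suc i) j = zero≈δ₂ _
  X-mono (suc (suc n)) i j = zero≈δ₁ _

  Y-mono : Y ≋ mono 1# 0 1 0
  Y-mono (suc n) i j = zero≈δ₁ _
  Y-mono zero zero j = zero≈δ₂ _
  Y-mono zero (suc zero) zero = one≈δ₃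
  Y-mono zero (suc zero) (suc j) = zero≈δ₃
  Y-mono zero (suc (suc i)) j = zero≈δ₂ _

  Z-mono : Z ≋ mono 1# 0 0 1
  Z-mono (suc n) i j = zero≈δ₁ _
  Z-mono zero (suc i) j = zero≈δ₂ _
  Z-mono zero zero zero = zero≈δ₃
  Z-mono zero zero (suc zero) = one≈δ₃
  Z-mono zero zero (suc (suc j)) = zero≈δ₃

  powR : Carrier → ℕ → Carrier
  powR r zero = 1#
  powR r (suc k) = r * powR r k

  powR-cong : ∀ {x y} j → x ≈ y → powR x j ≈ powR y j
  powR-cong zero x≈y = refl
  powR-cong (suc j) x≈y = *-cong x≈y (powR-cong j x≈y)

  powR-1# : ∀ q → powR 1# q ≈ 1#
  powR-1# zero = refl
  powR-1# (suc q) = trans (*-identityˡ _) (powR-1# q)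

  pow-mono : ∀ {F r a b d} → F ≋ mono r a b d → ∀ q →
    F ^^ q ≋ mono (powR r q) (q ℕ.* a) (q ℕ.* b) (q ℕ.* d)
  pow-mono F≋mono zero = const-mono
  pow-mono {F} {r} {a} {b} {d} F≋mono (suc q) =
    ≋-trans (⊗-cong F≋mono (pow-mono F≋mono q)) (mono-mono r a b d _ _ _ _)

  powX : ∀ q → X ^^ q ≋ mono 1# q 0 0
  powX q = ≋-trans (pow-mono X-mono q) (mono-cong (powR-1# q) (ℕP.*-identityʳ q) (ℕP.*-zeroʳ q) (ℕP.*-zeroʳ q))

  powY : ∀ q → Y ^^ q ≋ mono 1# 0 q 0
  powY q = ≋-trans (pow-mono Y-mono q) (mono-cong (powR-1# q) (ℕP.*-zeroʳ q) (ℕP.*-identityʳ q) (ℕP.*-zeroʳ q))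

  powZ : ∀ q → Z ^^ q ≋ mono 1# 0 0 q
  powZ q = ≋-trans (pow-mono Z-mono q) (mono-cong (powR-1# q) (ℕP.*-zeroʳ q) (ℕP.*-zeroʳ q) (ℕP.*-identityʳ q))

  pow⊖X : ∀ q → (⊖ X) ^^ q ≋ mono (powR (- 1#) q) q 0 0
  pow⊖X q = ≋-trans (pow-mono (≋-trans (λ n i j → -‿cong (X-mono n i j)) (⊖-mono 1# 1 0 0)) q)
    (mono-cong refl (ℕP.*-identityʳ q) (ℕP.*-zeroʳ q) (ℕP.*-zeroʳ q))

  cZ-mono : ∀ x → x • Z ≋ mono x 0 0 1
  cZ-mono x = ≋-trans (λ n i j → *-congˡ (Z-mono n i j))
    (≋-trans (•-mono x 1# 0 0 1) (mono-cong {a = 0} {b = 0} {d = 1} (*-identityʳ x) P.refl P.refl P.refl))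

  pow-cZ : ∀ x q → (x • Z) ^^ q ≋ mono (powR x q) 0 0 q
  pow-cZ x q = ≋-trans (pow-mono (cZ-mono x) q) (mono-cong refl (ℕP.*-zeroʳ q) (ℕP.*-zeroʳ q) (ℕP.*-identityʳ q))

  natR-+ : ∀ a b → natR (a ℕ.+ b) ≈ natR a + natR b
  natR-+ a b = trans (reflexive (P.cong ι (nℚ-+ a b))) (+-homo _ _)

  natR-* : ∀ a b → natR (a ℕ.* b) ≈ natR a * natR b
  natR-* a b = trans (reflexive (P.cong ι (nℚ-* a b))) (*-homo _ _)

  binomR-0 : ∀ n → binomR n 0 ≈ 1#
  binomR-0 n = 1#-homo

  binomR-n : ∀ n → binomR n n ≈ 1#
  binomR-n n = trans (reflexive (P.cong natR (nCn≡1 n))) 1#-homo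

  binomR-suc-n : ∀ n → binomR n (suc n) ≈ 0#
  binomR-suc-n n = trans (reflexive (P.cong natR (k>n⇒nCk≡0 (ℕP.n<1+n n)))) 0#-homo

  binomR-pascal : ∀ n k → binomR (suc n) (suc k) ≈ binomR n k + binomR n (suc k)
  binomR-pascal n k =
    trans (reflexive (P.cong natR (P.sym (nCk+nC[k+1]≡[n+1]C[k+1] n k)))) (natR-+ (n C k) (n C suc k))

  binomR-absorb : ∀ n k → binomR (suc n) (suc k) * natR (suc k) ≈ natR (suc n) * binomR n k
  binomR-absorb n k = trans (*-comm _ _) (trans (sym (natR-* (suc k) (suc n C suc k)))
    (trans (reflexive (P.cong natR (suc-*-C n k))) (natR-* (suc n) (n C k))))

  ι-powℚ : ∀ q j → ι (powℚ q j) ≈ powR (ι q) j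
  ι-powℚ q zero = 1#-homo
  ι-powℚ q (suc j) = trans (*-homo _ _) (*-congˡ (ι-powℚ q j))

  ι-sumℚ : ∀ n g → ι (sumℚ n g) ≈ sumR n (λ k → ι (g k))
  ι-sumℚ zero g = refl
  ι-sumℚ (suc n) g = trans (+-homo _ _) (+-congʳ (ι-sumℚ n g))

  signR-pow : ∀ k → signR k ≈ powR (- 1#) k
  signR-pow k = trans (ι-powℚ _ k) (powR-cong k (trans (-‿homo _) (-‿cong 1#-homo)))

  signR-suc : ∀ k → signR (suc k) ≈ - signR k
  signR-suc k = trans (signR-pow (suc k)) (trans
    (solve 2 (λ o s → (:- o) :* s := :- (o :* s)) refl 1# (powR (- 1#) k))
    (-‿cong (trans (*-identityˡ _) (sym (signR-pow k)))))

  sign² : ∀ n → powR (- 1#) n * powR (- 1#) n ≈ 1#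
  sign² zero = *-identityˡ 1#
  sign² (suc n) = trans (solve 2 (λ o p → ((:- o) :* p) :* ((:- o) :* p) := (o :* o) :* (p :* p)) refl 1# (powR (- 1#) n))
    (trans (*-congʳ (*-identityˡ 1#)) (trans (*-identityˡ _) (sign² n)))

  binomialCoeff : Carrier → ℕ → ℕ → ℕ → Carrier
  binomialCoeff x m i j = δ m (i ℕ.+ j) * (binomR m j * powR x j)

  -- On the diagonal j = m both C(m,j) and C(m+1,j+1) equal 1.
  δ-binomR-diagonal : ∀ m j → δ m j * binomR m j ≈ δ m j * binomR (suc m) (suc j)
  δ-binomR-diagonal m j = begin
    δ m j * binomR m j ≈⟨ sym (δ-subst m j (binomR m)) ⟩
    δ m j * binomR m m ≈⟨ *-congˡ (trans (binomR-n m) (sym (binomR-n (suc m)))) ⟩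
    δ m j * binomR (suc m) (suc m) ≈⟨ δ-subst m j (λ t → binomR (suc m) (suc t)) ⟩
    δ m j * binomR (suc m) (suc j) ∎

  -- Pascal's rule for binomialCoeff, i.e. multiplication by Y + cZ.
  binomialCoeff-step : ∀ x m i j →
    ind≤ 1 i * binomialCoeff x m (i ∸ 1) j + x * (ind≤ 1 j * binomialCoeff x m i (j ∸ 1))
      ≈ binomialCoeff x (suc m) i j
  binomialCoeff-step x m zero zero = begin
    0# * _ + x * (0# * _) ≈⟨ +-cong (zeroˡ _) (trans (*-congˡ (zeroˡ _)) (zeroʳ x)) ⟩
    0# + 0# ≈⟨ +-identityˡ 0# ⟩
    0# ≈⟨ sym (zeroˡ _) ⟩
    binomialCoeff x (suc m) 0 0 ∎
  binomialCoeff-step x m (suc i) zero = begin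
    1# * binomialCoeff x m i 0 + x * (0# * _) ≈⟨ +-cong (*-identityˡ _) (trans (*-congˡ (zeroˡ _)) (zeroʳ x)) ⟩
    binomialCoeff x m i 0 + 0# ≈⟨ +-identityʳ _ ⟩
    binomialCoeff x (suc m) (suc i) 0 ∎
  binomialCoeff-step x m zero (suc j) = begin
    0# * _ + x * (1# * (δ m j * (binomR m j * powR x j)))
      ≈⟨ trans (+-congʳ (zeroˡ _)) (trans (+-identityˡ _) (*-congˡ (*-identityˡ _))) ⟩
    x * (δ m j * (binomR m j * powR x j))
      ≈⟨ solve 4 (λ x E C p → x :* (E :* (C :* p)) := (E :* C) :* (x :* p)) refl x _ _ _ ⟩
    (δ m j * binomR m j) * (x * powR x j) ≈⟨ *-congʳ (δ-binomR-diagonal m j) ⟩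
    (δ m j * binomR (suc m) (suc j)) * (x * powR x j) ≈⟨ *-assoc _ _ _ ⟩
    binomialCoeff x (suc m) 0 (suc j) ∎
  binomialCoeff-step x m (suc i) (suc j) = begin
    1# * (E′ * (Cb * (x * p))) + x * (1# * (E * (Ca * p)))
      ≈⟨ +-cong (trans (*-identityˡ _) (*-congʳ E′≈E)) (*-congˡ (*-identityˡ _)) ⟩
    E * (Cb * (x * p)) + x * (E * (Ca * p))
      ≈⟨ solve 5 (λ x E Cb Ca p → E :* (Cb :* (x :* p)) :+ x :* (E :* (Ca :* p)) := E :* ((Ca :+ Cb) :* (x :* p)))
           refl x E Cb Ca p ⟩
    E * ((Ca + Cb) * (x * p)) ≈⟨ *-congˡ (*-congʳ (sym (binomR-pascal m j))) ⟩
    E * (binomR (suc m) (suc j) * (x * p)) ≈⟨ *-congʳ (sym E′≈E) ⟩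
    binomialCoeff x (suc m) (suc i) (suc j) ∎
    where
    E′ = δ m (i ℕ.+ suc j)
    E = δ m (suc (i ℕ.+ j))
    Ca = binomR m j
    Cb = binomR m (suc j)
    p = powR x j
    E′≈E : E′ ≈ E
    E′≈E = reflexive (P.cong (δ m) (ℕP.+-suc i j))

  binomialSeries : Carrier → ℕ → PS3
  binomialSeries x m n i j = δ 0 n * binomialCoeff x m i j

  binomial-theorem : ∀ x m → (Y ⊕ (x • Z)) ^^ m ≋ binomialSeries x m
  binomial-theorem x zero = ≋-trans const-mono unit
    where
    unit : mono 1# 0 0 0 ≋ binomialSeries x 0
    unit n zero zero = trans (*-identityˡ _) (*-congˡ (*-congˡ (sym (trans (*-identityʳ _) (binomR-0 0)))))
    unit n zero (suc j) = trans (*-identityˡ _) (*-congˡ (trans (*-identityˡ _) (sym (zeroˡ _))))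
    unit n (suc i) j = trans (*-identityˡ _) (*-congˡ (trans (zeroˡ _) (sym (zeroˡ _))))
  binomial-theorem x (suc m) n i j = begin
    ((Y ⊕ (x • Z)) ⊗ ((Y ⊕ (x • Z)) ^^ m)) n i j
      ≈⟨ ⊗-cong (λ n i j → +-cong (Y-mono n i j) (cZ-mono x n i j)) (binomial-theorem x m) n i j ⟩
    ((mono 1# 0 1 0 ⊕ mono x 0 0 1) ⊗ B) n i j
      ≈⟨ ⊕-⊗ (mono 1# 0 1 0) (mono x 0 0 1) B n i j ⟩
    (mono 1# 0 1 0 ⊗ B) n i j + (mono x 0 0 1 ⊗ B) n i j
      ≈⟨ +-cong (mono-⊗ 1# 0 1 0 B n i j) (mono-⊗ x 0 0 1 B n i j) ⟩
    1# * (1# * (ind≤ 1 i * (1# * B n (i ∸ 1) j))) + x * (1# * (1# * (ind≤ 1 j * B n i (j ∸ 1))))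
      ≈⟨ +-cong (trans (*-identityˡ _) (trans (*-identityˡ _) (*-congˡ (*-identityˡ _))))
                (*-congˡ (trans (*-identityˡ _) (*-identityˡ _))) ⟩
    ind≤ 1 i * (δ 0 n * b (i ∸ 1) j) + x * (ind≤ 1 j * (δ 0 n * b i (j ∸ 1)))
      ≈⟨ solve 6 (λ l D u x l′ v → l :* (D :* u) :+ x :* (l′ :* (D :* v)) := D :* (l :* u :+ x :* (l′ :* v)))
           refl _ _ _ x _ _ ⟩
    δ 0 n * (ind≤ 1 i * b (i ∸ 1) j + x * (ind≤ 1 j * b i (j ∸ 1)))
      ≈⟨ *-congˡ (binomialCoeff-step x m i j) ⟩
    binomialSeries x (suc m) n i j ∎
    where
    B = binomialSeries x m
    b = binomialCoeff x m

  -- Alternating binomial sums  Δ c n j = Σ_{k ≤ n} C(n,k) (-1)^k (k + c)^j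
  -- (up to sign the n-th forward difference of t ↦ (t + c)^j at 0).

  signedBinom : ℕ → ℕ → Carrier
  signedBinom n k = binomR n k * signR k

  signedBinom-pascal : ∀ n (g : ℕ → Carrier) →
    sumR (suc n) (λ k → signedBinom (suc n) k * g k)
      ≈ sumR n (λ k → signedBinom n k * g k) + - sumR n (λ k → signedBinom n k * g (suc k))
  signedBinom-pascal n g = begin
    sumR (suc n) (λ k → signedBinom (suc n) k * g k) ≈⟨ sumR-shift n _ ⟩
    w 0 * g 0 + sumR n (λ k → signedBinom (suc n) (suc k) * g (suc k))
      ≈⟨ +-congˡ (trans (sumR-cong n split) (sumR-+ n _ _)) ⟩
    w 0 * g 0 + (sumR n (λ k → w (suc k) * g (suc k)) + sumR n (λ k → - (w k * g (suc k))))
      ≈⟨ sym (+-assoc _ _ _) ⟩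
    (w 0 * g 0 + sumR n (λ k → w (suc k) * g (suc k))) + sumR n (λ k → - (w k * g (suc k)))
      ≈⟨ +-cong (sym (sumR-shift n _)) (sumR-neg n _) ⟩
    (sumR n (λ k → w k * g k) + w (suc n) * g (suc n)) + - sumR n (λ k → w k * g (suc k))
      ≈⟨ +-congʳ (trans (+-congˡ (trans (*-congʳ (trans (*-congʳ (binomR-suc-n n)) (zeroˡ _))) (zeroˡ _)))
                        (+-identityʳ _)) ⟩
    sumR n (λ k → w k * g k) + - sumR n (λ k → w k * g (suc k)) ∎
    where
    w : ℕ → Carrier
    w = signedBinom n
    split : ∀ k → signedBinom (suc n) (suc k) * g (suc k) ≈ w (suc k) * g (suc k) + - (w k * g (suc k))
    split k = begin
      (binomR (suc n) (suc k) * signR (suc k)) * g (suc k)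
        ≈⟨ *-congʳ (*-cong (binomR-pascal n k) (signR-suc k)) ⟩
      ((binomR n k + binomR n (suc k)) * (- signR k)) * g (suc k)
        ≈⟨ solve 4 (λ b₁ b₂ s g → ((b₁ :+ b₂) :* (:- s)) :* g := (b₂ :* (:- s)) :* g :+ :- ((b₁ :* s) :* g))
             refl _ _ _ _ ⟩
      (binomR n (suc k) * (- signR k)) * g (suc k) + - (w k * g (suc k))
        ≈⟨ +-congʳ (*-congʳ (*-congˡ (sym (signR-suc k)))) ⟩
      w (suc k) * g (suc k) + - (w k * g (suc k)) ∎

  signedBinom-absorb : ∀ n (h : ℕ → Carrier) →
    sumR (suc n) (λ k → signedBinom (suc n) k * (natR k * h k))
      ≈ - (natR (suc n) * sumR n (λ k → signedBinom n k * h (suc k)))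
  signedBinom-absorb n h = begin
    sumR (suc n) (λ k → signedBinom (suc n) k * (natR k * h k)) ≈⟨ sumR-shift n _ ⟩
    signedBinom (suc n) 0 * (natR 0 * h 0) + sumR n (λ k → signedBinom (suc n) (suc k) * (natR (suc k) * h (suc k)))
      ≈⟨ +-cong (trans (*-congˡ (trans (*-congʳ 0#-homo) (zeroˡ _))) (zeroʳ _)) (sumR-cong n absorbed) ⟩
    0# + sumR n (λ k → - (natR (suc n) * (signedBinom n k * h (suc k))))
      ≈⟨ trans (+-identityˡ _) (sumR-neg n _) ⟩
    - sumR n (λ k → natR (suc n) * (signedBinom n k * h (suc k))) ≈⟨ -‿cong (sumR-*ˡ n _ _) ⟩
    - (natR (suc n) * sumR n (λ k → signedBinom n k * h (suc k))) ∎
    where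
    absorbed : ∀ k → signedBinom (suc n) (suc k) * (natR (suc k) * h (suc k))
                      ≈ - (natR (suc n) * (signedBinom n k * h (suc k)))
    absorbed k = begin
      (binomR (suc n) (suc k) * signR (suc k)) * (natR (suc k) * h (suc k))
        ≈⟨ solve 4 (λ b s nk g → (b :* s) :* (nk :* g) := (b :* nk) :* (s :* g)) refl _ _ _ _ ⟩
      (binomR (suc n) (suc k) * natR (suc k)) * (signR (suc k) * h (suc k))
        ≈⟨ *-cong (binomR-absorb n k) (*-congʳ (signR-suc k)) ⟩
      (natR (suc n) * binomR n k) * ((- signR k) * h (suc k))
        ≈⟨ solve 4 (λ N b s g → (N :* b) :* ((:- s) :* g) := :- (N :* ((b :* s) :* g))) refl _ _ _ _ ⟩
      - (natR (suc n) * (signedBinom n k * h (suc k))) ∎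

  Δ : Carrier → ℕ → ℕ → Carrier
  Δ c n j = sumR n (λ k → signedBinom n k * powR (natR k + c) j)

  -- Writing (k + c)^(j+1) = k (k + c)^j + c (k + c)^j lowers the exponent:
  --   Δ c (n+1) (j+1) = -(n+1) Δ (1 + c) n j + c Δ c (n+1) j.
  Δ-step : ∀ c n j → Δ c (suc n) (suc j) ≈ - (natR (suc n) * Δ (1# + c) n j) + c * Δ c (suc n) j
  Δ-step c n j = begin
    sumR (suc n) (λ k → signedBinom (suc n) k * ((natR k + c) * P k))
      ≈⟨ sumR-cong (suc n) (λ k → solve 4 (λ W x c p → W :* ((x :+ c) :* p) := W :* (x :* p) :+ c :* (W :* p))
                                         refl _ _ _ _) ⟩
    sumR (suc n) (λ k → signedBinom (suc n) k * (natR k * P k) + c * (signedBinom (suc n) k * P k))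
      ≈⟨ sumR-+ (suc n) _ _ ⟩
    sumR (suc n) (λ k → signedBinom (suc n) k * (natR k * P k)) + sumR (suc n) (λ k → c * (signedBinom (suc n) k * P k))
      ≈⟨ +-cong (signedBinom-absorb n P) (sumR-*ˡ (suc n) _ _) ⟩
    - (natR (suc n) * sumR n (λ k → signedBinom n k * P (suc k))) + c * Δ c (suc n) j
      ≈⟨ +-congʳ (-‿cong (*-congˡ (sumR-cong n (λ k → *-congˡ (powR-cong j (shift k)))))) ⟩
    - (natR (suc n) * Δ (1# + c) n j) + c * Δ c (suc n) j ∎
    where
    P : ℕ → Carrier
    P k = powR (natR k + c) j
    shift : ∀ k → natR (suc k) + c ≈ natR k + (1# + c)
    shift k = trans (+-congʳ (trans (natR-+ 1 k) (+-congʳ 1#-homo)))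
      (solve 3 (λ o x c → (o :+ x) :+ c := x :+ (o :+ c)) refl 1# (natR k) c)

  Δ-vanishes : ∀ j n c → j ℕ.< n → Δ c n j ≈ 0#
  Δ-vanishes zero (suc n) c _ =
    trans (signedBinom-pascal n (λ _ → 1#)) (-‿inverseʳ _)
  Δ-vanishes (suc j) (suc n) c (ℕ.s≤s j<n) = begin
    Δ c (suc n) (suc j) ≈⟨ Δ-step c n j ⟩
    - (natR (suc n) * Δ (1# + c) n j) + c * Δ c (suc n) j
      ≈⟨ +-cong (-‿cong (*-congˡ (Δ-vanishes j n (1# + c) j<n)))
                (*-congˡ (Δ-vanishes j (suc n) c (ℕP.m≤n⇒m≤1+n j<n))) ⟩
    - (natR (suc n) * 0#) + c * 0# ≈⟨ +-cong (trans (-‿cong (zeroʳ _)) -0#≈0#) (zeroʳ c) ⟩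
    0# + 0# ≈⟨ +-identityʳ 0# ⟩
    0# ∎

  altPowerSum : ℕ → ℕ → Carrier
  altPowerSum n j = sumR n (λ k → signedBinom n k * powR (natR k) j)

  altPowerSum≈Δ : ∀ n j → altPowerSum n j ≈ Δ 0# n j
  altPowerSum≈Δ n j = sumR-cong n (λ k → *-congˡ (powR-cong j (sym (+-identityʳ _))))

  ι-Stirling2 : ∀ j n → ι (Stirling2 j n) ≈ signR n * ι (invFact n) * altPowerSum n j
  ι-Stirling2 j n = trans (*-homo _ _) (trans (*-congʳ (*-homo _ _))
    (*-congˡ (trans (ι-sumℚ n _) (sumR-cong n (λ k → trans (*-homo _ _) (*-cong (*-homo _ _) (ι-powℚ _ j)))))))

  -- Coefficient of x^n in φ_j(-x):  [n ≤ j] S(j,n) (-1)^n.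
  φ-coeff : ℕ → ℕ → Carrier
  φ-coeff j n = ind≤ n j * (ι (Stirling2 j n) * powR (- 1#) n)

  stirling-coefficient : ∀ n j → ι (invFact n) * altPowerSum n j ≈ φ-coeff j n
  stirling-coefficient n j with n ℕ.≤? j
  ... | yes n≤j = begin
    ι (invFact n) * altPowerSum n j ≈⟨ sym (*-identityˡ _) ⟩
    1# * (ι (invFact n) * altPowerSum n j)
      ≈⟨ *-congʳ (sym (trans (*-cong (signR-pow n) (signR-pow n)) (sign² n))) ⟩
    (signR n * signR n) * (ι (invFact n) * altPowerSum n j)
      ≈⟨ solve 3 (λ s f d → (s :* s) :* (f :* d) := (s :* f :* d) :* s) refl _ _ _ ⟩
    (signR n * ι (invFact n) * altPowerSum n j) * signR n
      ≈⟨ *-cong (sym (ι-Stirling2 j n)) (signR-pow n) ⟩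
    ι (Stirling2 j n) * powR (- 1#) n ≈⟨ sym (*-identityˡ _) ⟩
    1# * (ι (Stirling2 j n) * powR (- 1#) n) ≈⟨ *-congʳ (reflexive (P.sym (ind≤-≤ n≤j))) ⟩
    φ-coeff j n ∎
  ... | no n≰j = begin
    ι (invFact n) * altPowerSum n j ≈⟨ *-congˡ vanishes ⟩
    ι (invFact n) * 0# ≈⟨ zeroʳ _ ⟩
    0# ≈⟨ sym (zeroˡ _) ⟩
    0# * _ ≈⟨ *-congʳ (reflexive (P.sym (ind≤-> (ℕP.≰⇒> n≰j)))) ⟩
    φ-coeff j n ∎
    where
    vanishes : altPowerSum n j ≈ 0#
    vanishes = trans (altPowerSum≈Δ n j) (Δ-vanishes j n 0# (ℕP.≰⇒> n≰j))

  -- Coefficients of the building blocks.  In Σ∞ the coefficient of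
  -- x^n y^i z^j is a sum over m ≤ n + i + j, and every index selected
  -- below lies in that range.

  n≤deg : ∀ n i j → n ℕ.≤ n ℕ.+ i ℕ.+ j
  n≤deg n i j = ℕP.≤-trans (ℕP.m≤m+n n i) (ℕP.m≤m+n (n ℕ.+ i) j)

  j≤deg : ∀ n i j → j ℕ.≤ n ℕ.+ i ℕ.+ j
  j≤deg n i j = ℕP.m≤n+m j (n ℕ.+ i)

  i+j≤deg : ∀ n i j → i ℕ.+ j ℕ.≤ n ℕ.+ i ℕ.+ j
  i+j≤deg n i j = P.subst (i ℕ.+ j ℕ.≤_) (P.sym (ℕP.+-assoc n i j)) (ℕP.m≤n+m (i ℕ.+ j) n)

  φ⊖X-coeff : ∀ p n i j → φ p (⊖ X) n i j ≈ δ 0 i * (δ 0 j * φ-coeff p n)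
  φ⊖X-coeff p n i j = begin
    sumR p (λ q → ι (Stirling2 p q) * ((⊖ X) ^^ q) n i j)
      ≈⟨ sumR-cong p (λ q → trans (*-congˡ (pow⊖X q n i j))
           (solve 5 (λ S s dq di dj → S :* (s :* (dq :* (di :* dj))) := di :* (dj :* (dq :* (S :* s))))
              refl _ _ _ _ _)) ⟩
    sumR p (λ q → δ 0 i * (δ 0 j * (δ q n * (ι (Stirling2 p q) * powR (- 1#) q))))
      ≈⟨ trans (sumR-*ˡ p _ _) (*-congˡ (sumR-*ˡ p _ _)) ⟩
    δ 0 i * (δ 0 j * sumR p (λ q → δ q n * (ι (Stirling2 p q) * powR (- 1#) q)))
      ≈⟨ *-congˡ (*-congˡ (sumR-δ′ p n _)) ⟩
    δ 0 i * (δ 0 j * φ-coeff p n) ∎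

  compose-Y+cZ : ∀ (a : ℕ → Carrier) x n i j →
    compose a (Y ⊕ (x • Z)) n i j ≈ δ 0 n * ((a (i ℕ.+ j) * binomR (i ℕ.+ j) j) * powR x j)
  compose-Y+cZ a x n i j = begin
    sumR (n ℕ.+ i ℕ.+ j) (λ m → a m * ((Y ⊕ (x • Z)) ^^ m) n i j)
      ≈⟨ sumR-cong (n ℕ.+ i ℕ.+ j) (λ m → trans (*-congˡ (binomial-theorem x m n i j))
           (solve 5 (λ A D E b p → A :* (D :* (E :* (b :* p))) := D :* (E :* ((A :* b) :* p))) refl _ _ _ _ _)) ⟩
    sumR (n ℕ.+ i ℕ.+ j) (λ m → δ 0 n * (δ m (i ℕ.+ j) * ((a m * binomR m j) * powR x j)))
      ≈⟨ sumR-*ˡ (n ℕ.+ i ℕ.+ j) _ _ ⟩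
    δ 0 n * sumR (n ℕ.+ i ℕ.+ j) (λ m → δ m (i ℕ.+ j) * ((a m * binomR m j) * powR x j))
      ≈⟨ *-congˡ (sumR-δ≤′ _ (i+j≤deg n i j)) ⟩
    δ 0 n * ((a (i ℕ.+ j) * binomR (i ℕ.+ j) j) * powR x j) ∎

  compose-cZ : ∀ (a : ℕ → Carrier) x n i j →
    compose a (x • Z) n i j ≈ δ 0 n * ((δ 0 i * a j) * powR x j)
  compose-cZ a x n i j = begin
    sumR (n ℕ.+ i ℕ.+ j) (λ m → a m * ((x • Z) ^^ m) n i j)
      ≈⟨ sumR-cong (n ℕ.+ i ℕ.+ j) (λ m → trans (*-congˡ (pow-cZ x m n i j))
           (solve 5 (λ A p D E F → A :* (p :* (D :* (E :* F))) := D :* (F :* ((E :* A) :* p))) refl _ _ _ _ _)) ⟩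
    sumR (n ℕ.+ i ℕ.+ j) (λ m → δ 0 n * (δ m j * ((δ 0 i * a m) * powR x m)))
      ≈⟨ sumR-*ˡ (n ℕ.+ i ℕ.+ j) _ _ ⟩
    δ 0 n * sumR (n ℕ.+ i ℕ.+ j) (λ m → δ m j * ((δ 0 i * a m) * powR x m))
      ≈⟨ *-congˡ (sumR-δ≤′ _ (j≤deg n i j)) ⟩
    δ 0 n * ((δ 0 i * a j) * powR x j) ∎

  lhs-coefficient : ∀ (a : ℕ → Carrier) (G : ℕ → PS3) (A : ℕ → ℕ → Carrier) →
    (∀ k n i j → compose a (G k) n i j ≈ δ 0 n * (A i j * powR (natR k) j)) →
    ∀ n i j → Σ∞ (λ N → (ι (invFact N) • (X ^^ N)) ⊗ sumPS N (λ k → signedBinom N k • compose a (G k))) n i j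
      ≈ ι (invFact n) * (A i j * altPowerSum n j)
  lhs-coefficient a G A fG n i j = begin
    sumR (n ℕ.+ i ℕ.+ j) (λ N → ((ι (invFact N) • (X ^^ N)) ⊗ T N) n i j)
      ≈⟨ sumR-cong (n ℕ.+ i ℕ.+ j) term ⟩
    sumR (n ℕ.+ i ℕ.+ j) (λ N → δ N n * (ι (invFact N) * U N))
      ≈⟨ sumR-δ≤′ _ (n≤deg n i j) ⟩
    ι (invFact n) * U n
      ≈⟨ *-congˡ (trans (sumR-cong n (λ k → solve 3 (λ W A p → W :* (A :* p) := A :* (W :* p)) refl _ _ _))
                        (sumR-*ˡ n _ _)) ⟩
    ι (invFact n) * (A i j * altPowerSum n j) ∎
    where
    T : ℕ → PS3
    T N = sumPS N (λ k → signedBinom N k • compose a (G k))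
    U : ℕ → Carrier
    U N = sumR N (λ k → signedBinom N k * (A i j * powR (natR k) j))
    T-coeff : ∀ N n′ → T N n′ i j ≈ δ 0 n′ * U N
    T-coeff N n′ = trans (sumR-cong N (λ k → trans (*-congˡ (fG k n′ i j))
      (solve 3 (λ W D V → W :* (D :* V) := D :* (W :* V)) refl _ _ _))) (sumR-*ˡ N _ _)
    term : ∀ N → ((ι (invFact N) • (X ^^ N)) ⊗ T N) n i j ≈ δ N n * (ι (invFact N) * U N)
    term N = begin
      ((ι (invFact N) • (X ^^ N)) ⊗ T N) n i j
        ≈⟨ ⊗-cong (≋-trans (λ n i j → *-congˡ (powX N n i j)) (•-mono (ι (invFact N)) 1# N 0 0)) (≋-refl (T N)) n i j ⟩
      (mono (ι (invFact N) * 1#) N 0 0 ⊗ T N) n i j ≈⟨ mono-⊗ _ N 0 0 (T N) n i j ⟩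
      (ι (invFact N) * 1#) * (ind≤ N n * (1# * (1# * T N (n ∸ N) i j)))
        ≈⟨ *-cong (*-identityʳ _) (*-congˡ (trans (*-identityˡ _) (trans (*-identityˡ _) (T-coeff N (n ∸ N))))) ⟩
      ι (invFact N) * (ind≤ N n * (δ 0 (n ∸ N) * U N))
        ≈⟨ solve 4 (λ r l d u → r :* (l :* (d :* u)) := (l :* d) :* (r :* u)) refl _ _ _ _ ⟩
      (ind≤ N n * δ 0 (n ∸ N)) * (ι (invFact N) * U N) ≈⟨ *-congʳ (ind≤-δ0 N n) ⟩
      δ N n * (ι (invFact N) * U N) ∎

  rhs-general-coefficient : ∀ (a : ℕ → Carrier) n i j →
    Σ∞ (λ m → a m • sumPS m (λ p → binomR m p • ((Z ^^ p) ⊗ (Y ^^ (m ∸ p)) ⊗ φ p (⊖ X)))) n i j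
      ≈ (a (i ℕ.+ j) * binomR (i ℕ.+ j) j) * φ-coeff j n
  rhs-general-coefficient a n i j = begin
    sumR M (λ m → a m * sumR m (λ p → binomR m p * term m p n i j))
      ≈⟨ sumR-cong M (λ m → *-congˡ (trans (sumR-cong m (λ p → trans (*-congˡ (term-coeff m p))
           (solve 4 (λ b x y f → b :* (x :* (y :* f)) := y :* (b :* (x :* f))) refl _ _ _ _))) (sumR-δ′ m j _))) ⟩
    sumR M (λ m → a m * (ind≤ j m * (binomR m j * (δ (m ∸ j) i * φ-coeff j n))))
      ≈⟨ sumR-cong M (λ m → trans
           (solve 5 (λ A l b d f → A :* (l :* (b :* (d :* f))) := (l :* d) :* ((A :* b) :* f)) refl _ _ _ _ _)
           (*-congʳ (trans (*-congˡ (reflexive (δ-sym (m ∸ j) i))) (ind≤-δ j i m)))) ⟩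
    sumR M (λ m → δ (j ℕ.+ i) m * ((a m * binomR m j) * φ-coeff j n))
      ≈⟨ sumR-cong M (λ m → *-congʳ (reflexive (P.cong (λ t → δ t m) (ℕP.+-comm j i)))) ⟩
    sumR M (λ m → δ (i ℕ.+ j) m * ((a m * binomR m j) * φ-coeff j n))
      ≈⟨ sumR-δ≤ _ (i+j≤deg n i j) ⟩
    (a (i ℕ.+ j) * binomR (i ℕ.+ j) j) * φ-coeff j n ∎
    where
    M = n ℕ.+ i ℕ.+ j
    term : ℕ → ℕ → PS3
    term m p = (Z ^^ p) ⊗ (Y ^^ (m ∸ p)) ⊗ φ p (⊖ X)
    ZY-mono : ∀ m p → (Z ^^ p) ⊗ (Y ^^ (m ∸ p)) ≋ mono 1# 0 (m ∸ p) p
    ZY-mono m p = ≋-trans (⊗-cong (powZ p) (powY (m ∸ p)))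
      (≋-trans (mono-mono 1# 0 0 p 1# 0 (m ∸ p) 0) (mono-cong {a = 0} {b = m ∸ p} {d = p ℕ.+ 0} (*-identityˡ 1#) P.refl P.refl (ℕP.+-identityʳ p)))
    term-coeff : ∀ m p → term m p n i j ≈ δ (m ∸ p) i * (δ p j * φ-coeff p n)
    term-coeff m p = begin
      term m p n i j ≈⟨ ⊗-cong (ZY-mono m p) (≋-refl (φ p (⊖ X))) n i j ⟩
      (mono 1# 0 (m ∸ p) p ⊗ φ p (⊖ X)) n i j ≈⟨ mono-⊗ 1# 0 (m ∸ p) p (φ p (⊖ X)) n i j ⟩
      1# * (1# * (ind≤ (m ∸ p) i * (ind≤ p j * φ p (⊖ X) n (i ∸ (m ∸ p)) (j ∸ p))))
        ≈⟨ trans (*-identityˡ _) (trans (*-identityˡ _) (*-congˡ (*-congˡ (φ⊖X-coeff p n _ _)))) ⟩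
      ind≤ (m ∸ p) i * (ind≤ p j * (δ 0 (i ∸ (m ∸ p)) * (δ 0 (j ∸ p) * φ-coeff p n)))
        ≈⟨ solve 5 (λ l₁ l₂ d₁ d₂ f → l₁ :* (l₂ :* (d₁ :* (d₂ :* f))) := (l₁ :* d₁) :* ((l₂ :* d₂) :* f))
             refl _ _ _ _ _ ⟩
      (ind≤ (m ∸ p) i * δ 0 (i ∸ (m ∸ p))) * ((ind≤ p j * δ 0 (j ∸ p)) * φ-coeff p n)
        ≈⟨ *-cong (ind≤-δ0 (m ∸ p) i) (*-congʳ (ind≤-δ0 p j)) ⟩
      δ (m ∸ p) i * (δ p j * φ-coeff p n) ∎

  rhs-special-coefficient : ∀ (a : ℕ → Carrier) n i j →
    Σ∞ (λ m → a m • (φ m (⊖ X) ⊗ (Z ^^ m))) n i j ≈ (δ 0 i * a j) * φ-coeff j n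
  rhs-special-coefficient a n i j = begin
    sumR (n ℕ.+ i ℕ.+ j) (λ m → a m * (φ m (⊖ X) ⊗ (Z ^^ m)) n i j)
      ≈⟨ sumR-cong (n ℕ.+ i ℕ.+ j) (λ m → trans (*-congˡ (term-coeff m))
           (solve 4 (λ A f d e → A :* (f :* (d :* e)) := e :* ((d :* A) :* f)) refl _ _ _ _)) ⟩
    sumR (n ℕ.+ i ℕ.+ j) (λ m → δ m j * ((δ 0 i * a m) * φ-coeff m n)) ≈⟨ sumR-δ≤′ _ (j≤deg n i j) ⟩
    (δ 0 i * a j) * φ-coeff j n ∎
    where
    term-coeff : ∀ m → (φ m (⊖ X) ⊗ (Z ^^ m)) n i j ≈ φ-coeff m n * (δ 0 i * δ m j)
    term-coeff m = begin
      (φ m (⊖ X) ⊗ (Z ^^ m)) n i j ≈⟨ ⊗-cong (≋-refl (φ m (⊖ X))) (powZ m) n i j ⟩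
      sumR n (λ x → sumR i (λ b → sumR j (λ d →
        φ m (⊖ X) x b d * (1# * (δ 0 (n ∸ x) * (δ 0 (i ∸ b) * δ m (j ∸ d)))))))
        ≈⟨ sumR-cong n (λ x → sumR-cong i (λ b → trans (sumR-cong j (λ d → trans (*-congʳ (φ⊖X-coeff m x b d))
              (solve 4 (λ u v f r → (u :* (v :* f)) :* r := u :* (v :* (f :* r))) refl _ _ _ _)))
              (trans (sumR-*ˡ j _ _) (*-congˡ (sumR-δ≤ {j} {0} _ ℕ.z≤n))))) ⟩
      sumR n (λ x → sumR i (λ b → δ 0 b * (φ-coeff m x * (1# * (δ 0 (n ∸ x) * (δ 0 (i ∸ b) * δ m j))))))
        ≈⟨ sumR-cong n (λ x → sumR-δ≤ {i} {0} _ ℕ.z≤n) ⟩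
      sumR n (λ x → φ-coeff m x * (1# * (δ 0 (n ∸ x) * (δ 0 i * δ m j))))
        ≈⟨ sumR-cong≤ n (λ x x≤n → trans (*-congˡ (*-identityˡ _))
              (trans (solve 3 (λ f d e → f :* (d :* e) := d :* (f :* e)) refl _ _ _)
                (*-congʳ (reflexive (P.trans (δ0-∸ x≤n) (δ-sym x n)))))) ⟩
      sumR n (λ x → δ n x * (φ-coeff m x * (δ 0 i * δ m j))) ≈⟨ sumR-δ≤ {n} {n} _ ℕP.≤-refl ⟩
      φ-coeff m n * (δ 0 i * δ m j) ∎

  matching-coefficients : ∀ A n j → ι (invFact n) * (A * altPowerSum n j) ≈ A * φ-coeff j n
  matching-coefficients A n j =
    trans (solve 3 (λ f A d → f :* (A :* d) := A :* (f :* d)) refl _ _ _) (*-congˡ (stirling-coefficient n j))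

  general-identity : ∀ (a : ℕ → Carrier) →
    Σ∞ (λ n → (ι (invFact n) • (X ^^ n)) ⊗ sumPS n (λ k → (binomR n k * signR k) • compose a (Y ⊕ (natR k • Z))))
      ≋ Σ∞ (λ m → a m • sumPS m (λ p → binomR m p • ((Z ^^ p) ⊗ (Y ^^ (m ∸ p)) ⊗ φ p (⊖ X))))
  general-identity a n i j =
    trans (lhs-coefficient a (λ k → Y ⊕ (natR k • Z)) (λ i j → a (i ℕ.+ j) * binomR (i ℕ.+ j) j)
                           (λ k → compose-Y+cZ a (natR k)) n i j)
   (trans (matching-coefficients _ n j)
          (sym (rhs-general-coefficient a n i j)))

  special-identity : ∀ (a : ℕ → Carrier) →
    Σ∞ (λ n → (ι (invFact n) • (X ^^ n)) ⊗ sumPS n (λ k → (binomR n k * signR k) • compose a (natR k • Z)))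
      ≋ Σ∞ (λ m → a m • (φ m (⊖ X) ⊗ (Z ^^ m)))
  special-identity a n i j =
    trans (lhs-coefficient a (λ k → natR k • Z) (λ i j → δ 0 i * a j) (λ k → compose-cZ a (natR k)) n i j)
   (trans (matching-coefficients _ n j)
          (sym (rhs-special-coefficient a n i j)))

theorem1 : {c ℓ : Level} (R : CommutativeRing c ℓ)
    (ι : ℚ → CommutativeRing.Carrier R) →
    IsRingHomomorphism (CommutativeRing.rawRing +-*-commutativeRing) (CommutativeRing.rawRing R) ι →
    (a : ℕ → CommutativeRing.Carrier R) →
    let open PS R ι in
    (Σ∞ (λ n → (ι (invFact n) • (X ^^ n)) ⊗ sumPS n (λ k → (CommutativeRing._*_ R (binomR n k) (signR k)) • compose a (Y ⊕ (natR k • Z))))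
    ≋ Σ∞ (λ m → a m • sumPS m (λ p → binomR m p • ((Z ^^ p) ⊗ (Y ^^ (m ∸ p)) ⊗ φ p (⊖ X)))))
    ×
    (Σ∞ (λ n → (ι (invFact n) • (X ^^ n)) ⊗ sumPS n (λ k → (CommutativeRing._*_ R (binomR n k) (signR k)) • compose a (natR k • Z)))
    ≋ Σ∞ (λ m → a m • (φ m (⊖ X) ⊗ (Z ^^ m))))
theorem1 R ι hom a = general-identity a , special-identity a
  where open Coefficients R ι hom
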